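{- Let $n\ge2$. If a permutation $\lambda$ with $21\le\lambda<\pi_n$ omits a position $i\in[2n+2]$, i.e. there is no embedding $f$ of $\lambda$ into $\pi_n$ with $i$ in the image of $f$, then $\lambda$ is vanishing, i.e. $\mu(21,\lambda)\cdot\sum_{\tau\in[\lambda,\pi_n]}(-1)^{|\tau|}E(\tau,\pi_n)=0$.
   Context: Permutations of size $n$ are bijections of $[n]$ written as value sequences. An embedding of $\sigma\in\mathcal{S}_k$ into $\pi\in\mathcal{S}_N$ is a strictly increasing $f\colon[k]\to[N]$ with $\pi(f(1)),\dots,\pi(f(k))$ order-isomorphic to $\sigma$; $E(\sigma,\pi)$ is the number of embeddings; $\sigma\le\pi$ iff $E(\sigma,\pi)>0$; $[x,y]=\{z:x\le z\le y\}$; $\mu$ is the Möbius function of this poset ($\mu(x,y)=0$ if $x\not\le y$, $\mu(x,x)=1$, $\mu(x,y)=-\sum_{x\le z<y}\mu(x,z)$ for $x<y$). For $n\ge1$, $\pi_n\in\mathcal{S}_{2n+2}$ is given by $\pi_n(1)=n+1$, $\pi_n(2i)=i$ and $\pi_n(2i+1)=n+2+i$ for $1\le i\le n$, $\pi_n(2n+2)=n+2$. -}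

module Defs where

open import Data.Bool using (Bool; true; false; _∧_; not; if_then_else_)
open import Data.Nat using (ℕ; zero; suc; _+_; _<_; _<ᵇ_; _≡ᵇ_)
import Data.Nat as ℕ
open import Data.Integer as ℤ using (ℤ; +_; -_)
open import Data.List using (List; []; _∷_; _++_; map; concat; concatMap; filter; length; foldr; upTo; zip)
open import Data.List.Properties using (≡-dec)
open import Data.List.Membership.Propositional using (_∈_; _∉_)
open import Data.List.Relation.Binary.Permutation.Propositional using (_↭_)
open import Data.Product using (_×_; _,_)
open import Relation.Nullary using (¬_; does)
open import Relation.Nullary.Decidable using (T?)
open import Relation.Binary.PropositionalEquality using (_≡_)

-- Permutations are value sequences (lists of naturals), values 1..k.

oneTo : ℕ → List ℕ
oneTo k = map suc (upTo k)

IsPerm : List ℕ → Set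
IsPerm p = p ↭ oneTo (length p)

_⇔ᵇ_ : Bool → Bool → Bool
true  ⇔ᵇ b = b
false ⇔ᵇ b = not b

allᵇ : {A : Set} → (A → Bool) → List A → Bool
allᵇ p = foldr (λ a b → p a ∧ b) true

ordIso : List ℕ → List ℕ → Bool
ordIso [] [] = true
ordIso [] (_ ∷ _) = false
ordIso (_ ∷ _) [] = false
ordIso (x ∷ xs) (y ∷ ys) =
  allᵇ (λ { (x' , y') → ((x <ᵇ x') ⇔ᵇ (y <ᵇ y')) ∧ ((x' <ᵇ x) ⇔ᵇ (y' <ᵇ y)) }) (zip xs ys)
  ∧ ordIso xs ys

-- strictly increasing sublists of length k of a list
-- (applied to the increasing list of positions [1..N], these are exactly the
-- images of strictly increasing maps [k] → [N], listed without repetition)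
choose : ℕ → List ℕ → List (List ℕ)
choose zero    _        = [] ∷ []
choose (suc k) []       = []
choose (suc k) (x ∷ xs) = map (x ∷_) (choose k xs) ++ choose (suc k) xs

-- value of π at (1-based) position i (0 if out of range)
at : List ℕ → ℕ → ℕ
at []       _             = 0
at (x ∷ xs) zero          = 0
at (x ∷ xs) (suc zero)    = x
at (x ∷ xs) (suc (suc i)) = at xs (suc i)

-- Embeddings of σ into π, each given by its list of image positions
-- f(1) < ... < f(k) (1-based positions in π).
embeddings : List ℕ → List ℕ → List (List ℕ)
embeddings σ π =
  filter (λ S → T? (ordIso σ (map (at π) S)))
         (choose (length σ) (oneTo (length π)))

E : List ℕ → List ℕ → ℕ
E σ π = length (embeddings σ π)

_≤P_ : List ℕ → List ℕ → Set
σ ≤P π = 0 < E σ π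

_<P_ : List ℕ → List ℕ → Set
σ <P π = σ ≤P π × ¬ (σ ≡ π)

_≤ᵇP_ : List ℕ → List ℕ → Bool
σ ≤ᵇP π = 0 <ᵇ E σ π

_==ᵇ_ : List ℕ → List ℕ → Bool
x ==ᵇ y = does (≡-dec ℕ._≟_ x y)

insertAll : ℕ → List ℕ → List (List ℕ)
insertAll v []       = (v ∷ []) ∷ []
insertAll v (x ∷ xs) = (v ∷ x ∷ xs) ∷ map (x ∷_) (insertAll v xs)

allPerms : ℕ → List (List ℕ)
allPerms zero    = [] ∷ []
allPerms (suc m) = concatMap (insertAll (suc m)) (allPerms m)

sumℤ : List ℤ → ℤ
sumℤ = foldr ℤ._+_ (+ 0)

permsBelow : ℕ → List (List ℕ)
permsBelow s = concatMap allPerms (upTo s)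

-- Möbius function of the permutation pattern poset.
-- μ(x,y) = 0 if x ≰ y, μ(x,x) = 1, μ(x,y) = - Σ_{x ≤ z < y} μ(x,z).
-- z < y forces |z| < |y|, so the sum ranges over permutations z of size
-- < |y| with x ≤ z ≤ y; recursion is on a fuel parameter equal to |y|.

μ' : ℕ → List ℕ → List ℕ → ℤ
μ' zero x y = if (x ≤ᵇP y) ∧ (x ==ᵇ y) then + 1 else + 0
μ' (suc f) x y =
  if not (x ≤ᵇP y) then + 0 else
  (if x ==ᵇ y then + 1 else
   - sumℤ (map (μ' f x)
                (filter (λ z → T? ((x ≤ᵇP z) ∧ (z ≤ᵇP y)))
                        (permsBelow (length y)))))

μ : List ℕ → List ℕ → ℤ
μ x y = μ' (length y) x y

sign : ℕ → ℤ
sign zero    = + 1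
sign (suc m) = - sign m

intervalSum : List ℕ → List ℕ → ℤ
intervalSum lam π =
  sumℤ (map (λ τ → sign (length τ) ℤ.* (+ E τ π))
            (filter (λ τ → T? ((lam ≤ᵇP τ) ∧ (τ ≤ᵇP π)))
                    (permsBelow (suc (length π)))))

Vanishing : List ℕ → List ℕ → Set
Vanishing lam π = μ (2 ∷ 1 ∷ []) lam ℤ.* intervalSum lam π ≡ + 0

Omits : List ℕ → List ℕ → ℕ → Set
Omits lam π i = ∀ S → S ∈ embeddings lam π → i ∉ S

-- π_n ∈ S_{2n+2}: n+1, 1, n+3, 2, n+4, ..., n, 2n+2, n+2

πseq : ℕ → List ℕ
πseq n = (suc n) ∷ concat (map (λ i → i ∷ (n + 2 + i) ∷ []) (oneTo n)) ++ (n + 2) ∷ []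

-- Since π_n has distinct entries, every set S of positions of π_n carries exactly one pattern
-- of size |S|, so Σ_{τ ∈ [λ,π_n]} (-1)^|τ| E(τ,π_n) = Σ_{S ⊆ [2n+2]} (-1)^|S| [λ ≤ π_n|_S].
-- If λ omits position i, then [λ ≤ π_n|_S] does not change when i is added to or removed
-- from S, so the alternating sum cancels in pairs.
module Submission where

open import Defs
open import Data.Bool using (Bool; true; false; _∧_; T; if_then_else_)
open import Data.Bool.Properties using (∧-zeroʳ; ∧-commutativeMonoid)
open import Algebra.Bundles using (CommutativeMonoid)
open import Algebra.Properties.CommutativeSemigroup
  (CommutativeMonoid.commutativeSemigroup ∧-commutativeMonoid)
  using () renaming (interchange to ∧-interchange; x∙yz≈y∙xz to ∧-left-comm)
open import Data.Empty using (⊥-elim)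
open import Data.Integer as ℤ using (ℤ; +_; -_)
import Data.Integer.Properties as ℤ
open import Algebra.Properties.CommutativeSemigroup ℤ.+-commutativeSemigroup
  using () renaming (x∙yz≈y∙xz to ℤ+-left-comm; interchange to ℤ+-interchange)
open import Data.List
  using (List; []; _∷_; _++_; map; concat; concatMap; filter; length; upTo; applyUpTo; zip)
open import Data.List.Properties using (map-++; map-∘; map-applyUpTo; length-map; length-upTo; length-++)
open import Data.List.Membership.Propositional using (_∈_; _∉_)
open import Data.List.Membership.Propositional.Properties
  using ( ∈-++⁻; ∈-++⁺ˡ; ∈-++⁺ʳ; ∈-map⁻; ∈-map⁺; ∈-concat⁻′; ∈-filter⁺
        ; ∈-upTo⁺; ∈-upTo⁻; ∈-∃++)
open import Data.List.Relation.Unary.Any using (here; there)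
open import Data.List.Relation.Unary.All using ([])
open import Data.List.Relation.Unary.AllPairs using ([]; _∷_)
open import Data.List.Relation.Unary.Unique.Propositional using (Unique)
open import Data.List.Relation.Unary.Unique.Propositional.Properties as Unique using (Unique[x∷xs]⇒x∉xs)
open import Data.List.Relation.Unary.All.Properties using (¬Any⇒All¬)
open import Data.List.Relation.Binary.Sublist.Propositional
  using (_⊆_; []; _∷_; _∷ʳ_; ⊆-refl; ⊆-trans)
open import Data.List.Relation.Binary.Sublist.Propositional.Properties
  using ([]⊆-universal; All-resp-⊆; ++⁺) renaming (map⁺ to ⊆-map⁺)
open import Data.Nat as ℕ using (ℕ; zero; suc; _+_; _*_; _<_; _≤_; _<ᵇ_; z≤n; s≤s)
import Data.Nat.Properties as ℕ
open import Algebra.Properties.CommutativeSemigroup ℕ.+-commutativeSemigroup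
  using () renaming (interchange to +-interchange)
open import Data.Product using (∃; _×_; _,_; proj₁; proj₂)
open import Data.Sum using (_⊎_; inj₁; inj₂)
open import Data.Unit using (tt)
open import Function using (_∘_; case_of_)
open import Relation.Nullary.Decidable using (T?)
open import Relation.Binary.PropositionalEquality
open ≡-Reasoning

private variable
  A B : Set

∧-true⁻ˡ : ∀ {a b} → a ∧ b ≡ true → a ≡ true
∧-true⁻ˡ {true} _ = refl

∧-true⁻ʳ : ∀ {a b} → a ∧ b ≡ true → b ≡ true
∧-true⁻ʳ {true} ab = ab

∧-true⁺ : ∀ {a b} → a ≡ true → b ≡ true → a ∧ b ≡ true
∧-true⁺ refl refl = refl

≡true-ext : ∀ {a b} → (a ≡ true → b ≡ true) → (b ≡ true → a ≡ true) → a ≡ b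
≡true-ext {true}  {true}  _ _ = refl
≡true-ext {true}  {false} a⇒b _ = sym (a⇒b refl)
≡true-ext {false} {true}  _ b⇒a = b⇒a refl
≡true-ext {false} {false} _ _ = refl

⇔ᵇ-comm : ∀ a b → (a ⇔ᵇ b) ≡ (b ⇔ᵇ a)
⇔ᵇ-comm true  true  = refl
⇔ᵇ-comm true  false = refl
⇔ᵇ-comm false true  = refl
⇔ᵇ-comm false false = refl

⇔ᵇ-trans : ∀ a b c → (a ⇔ᵇ b) ≡ true → (b ⇔ᵇ c) ≡ true → (a ⇔ᵇ c) ≡ true
⇔ᵇ-trans true  true  c _ bc = bc
⇔ᵇ-trans false false c _ bc = bc

∧-absorbˡ : ∀ {a b} → (b ≡ true → a ≡ true) → a ∧ b ≡ b
∧-absorbˡ {true}          _   = refl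
∧-absorbˡ {false} {false} _   = refl
∧-absorbˡ {false} {true}  b⇒a = b⇒a refl

<ᵇ-true⇒< : ∀ a b → (a <ᵇ b) ≡ true → a < b
<ᵇ-true⇒< a b a<b = ℕ.<ᵇ⇒< a b (subst T (sym a<b) tt)

<⇒<ᵇ-true : ∀ {a b} → a < b → (a <ᵇ b) ≡ true
<⇒<ᵇ-true {a} {b} a<b with a <ᵇ b | ℕ.<⇒<ᵇ a<b
... | true | _ = refl

<ᵇ-false⇒≥ : ∀ a b → (a <ᵇ b) ≡ false → b ≤ a
<ᵇ-false⇒≥ a b a≮b = ℕ.≮⇒≥ λ a<b → case trans (sym (<⇒<ᵇ-true a<b)) a≮b of λ ()

<ᵇ-asym : ∀ a b → (a <ᵇ b) ≡ true → (b <ᵇ a) ≡ false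
<ᵇ-asym a b a<b with b <ᵇ a in b<a
... | false = refl
... | true  = ⊥-elim (ℕ.<-asym (<ᵇ-true⇒< a b a<b) (<ᵇ-true⇒< b a b<a))

allᵇ-∈ : (P : ℕ → Bool) {x : ℕ} (xs : List ℕ) → allᵇ P xs ≡ true → x ∈ xs → P x ≡ true
allᵇ-∈ P (y ∷ ys) all (here refl) = ∧-true⁻ˡ all
allᵇ-∈ P (y ∷ ys) all (there x∈) = allᵇ-∈ P ys (∧-true⁻ʳ all) x∈

allᵇ-false⁻ : (P : ℕ → Bool) (xs : List ℕ) → allᵇ P xs ≡ false → ∃ λ x → x ∈ xs × P x ≡ false
allᵇ-false⁻ P (y ∷ ys) notAll with P y in Py
... | false = y , here refl , Py
... | true  = let (x , x∈ , Px) = allᵇ-false⁻ P ys notAll in x , there x∈ , Px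

-- Finite sums

sumOver : List A → (A → ℕ) → ℕ
sumOver []       f = 0
sumOver (x ∷ xs) f = f x + sumOver xs f

infix 5 sumOver
syntax sumOver xs (λ x → e) = ∑[ x ← xs ] e

iverson : Bool → ℕ
iverson true  = 1
iverson false = 0

count : (A → Bool) → List A → ℕ
count P xs = ∑[ x ← xs ] iverson (P x)

∑-cong : (xs : List A) {f g : A → ℕ} → (∀ {x} → x ∈ xs → f x ≡ g x) →
         sumOver xs f ≡ sumOver xs g
∑-cong []       eq = refl
∑-cong (x ∷ xs) eq = cong₂ _+_ (eq (here refl)) (∑-cong xs (eq ∘ there))

∑-++ : (xs ys : List A) (f : A → ℕ) → sumOver (xs ++ ys) f ≡ sumOver xs f + sumOver ys f
∑-++ []       ys f = refl
∑-++ (x ∷ xs) ys f = trans (cong (f x ℕ.+_) (∑-++ xs ys f)) (sym (ℕ.+-assoc (f x) _ _))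

∑-map : (g : A → B) (xs : List A) (f : B → ℕ) → sumOver (map g xs) f ≡ ∑[ x ← xs ] f (g x)
∑-map g []       f = refl
∑-map g (x ∷ xs) f = cong (f (g x) ℕ.+_) (∑-map g xs f)

∑-concatMap : (h : A → List B) (xs : List A) (f : B → ℕ) →
              sumOver (concatMap h xs) f ≡ ∑[ x ← xs ] sumOver (h x) f
∑-concatMap h []       f = refl
∑-concatMap h (x ∷ xs) f =
  trans (∑-++ (h x) (concatMap h xs) f) (cong (sumOver (h x) f ℕ.+_) (∑-concatMap h xs f))

∑-zero : (xs : List A) → ∑[ x ← xs ] 0 ≡ 0
∑-zero []       = refl
∑-zero (_ ∷ xs) = ∑-zero xs

∑-+ : (xs : List A) (f g : A → ℕ) → ∑[ x ← xs ] (f x + g x) ≡ sumOver xs f + sumOver xs g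
∑-+ []       f g = refl
∑-+ (x ∷ xs) f g = trans (cong (f x + g x ℕ.+_) (∑-+ xs f g)) (+-interchange (f x) (g x) _ _)

∑-comm : (xs : List A) (ys : List B) (f : A → B → ℕ) →
         ∑[ x ← xs ] ∑[ y ← ys ] f x y ≡ ∑[ y ← ys ] ∑[ x ← xs ] f x y
∑-comm []       ys f = sym (∑-zero ys)
∑-comm (x ∷ xs) ys f = trans (cong (sumOver ys (f x) ℕ.+_) (∑-comm xs ys f)) (sym (∑-+ ys (f x) _))

length-filter≡count : (P : A → Bool) (xs : List A) →
                      length (filter (λ x → T? (P x)) xs) ≡ count P xs
length-filter≡count P []       = refl
length-filter≡count P (x ∷ xs) with P x
... | true  = cong suc (length-filter≡count P xs)
... | false = length-filter≡count P xs

iverson-*-count : (c : Bool) (P : A → Bool) (xs : List A) →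
                  iverson c * count P xs ≡ count (λ x → c ∧ P x) xs
iverson-*-count true  P xs = ℕ.+-identityʳ _
iverson-*-count false P xs = sym (∑-zero xs)

count-pos⁻ : (P : A → Bool) (xs : List A) → (0 <ᵇ count P xs) ≡ true → ∃ λ x → x ∈ xs × P x ≡ true
count-pos⁻ P (x ∷ xs) pos with P x in Px
... | true  = x , here refl , Px
... | false = let (y , y∈ , Py) = count-pos⁻ P xs pos in y , there y∈ , Py

count-pos⁺ : (P : A → Bool) {x : A} (xs : List A) → x ∈ xs → P x ≡ true → (0 <ᵇ count P xs) ≡ true
count-pos⁺ P (y ∷ xs) (here refl) Px rewrite Px = refl
count-pos⁺ P (y ∷ xs) (there x∈) Px with P y
... | true  = refl
... | false = count-pos⁺ P xs x∈ Px

sumBelow : ℕ → (ℕ → ℕ) → ℕ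
sumBelow zero    f = 0
sumBelow (suc M) f = f 0 + sumBelow M (f ∘ suc)

sumBelow-cong : (M : ℕ) {f g : ℕ → ℕ} → (∀ {p} → p < M → f p ≡ g p) → sumBelow M f ≡ sumBelow M g
sumBelow-cong zero    eq = refl
sumBelow-cong (suc M) eq = cong₂ _+_ (eq (s≤s z≤n)) (sumBelow-cong M (eq ∘ s≤s))

sumBelow-zero : (M : ℕ) → sumBelow M (λ _ → 0) ≡ 0
sumBelow-zero zero    = refl
sumBelow-zero (suc M) = sumBelow-zero M

∑-sumBelow-comm : (xs : List A) (M : ℕ) (f : A → ℕ → ℕ) →
                  ∑[ x ← xs ] sumBelow M (f x) ≡ sumBelow M (λ p → ∑[ x ← xs ] f x p)
∑-sumBelow-comm xs zero    f = ∑-zero xs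
∑-sumBelow-comm xs (suc M) f =
  trans (∑-+ xs (λ x → f x 0) (λ x → sumBelow M (f x ∘ suc)))
        (cong (ℕ._+_ (∑[ x ← xs ] f x 0)) (∑-sumBelow-comm xs M (λ x → f x ∘ suc)))

sumBelowℤ : ℕ → (ℕ → ℤ) → ℤ
sumBelowℤ zero    f = + 0
sumBelowℤ (suc M) f = f 0 ℤ.+ sumBelowℤ M (f ∘ suc)

sumBelowℤ-cong : (M : ℕ) {f g : ℕ → ℤ} → (∀ k → f k ≡ g k) → sumBelowℤ M f ≡ sumBelowℤ M g
sumBelowℤ-cong zero    eq = refl
sumBelowℤ-cong (suc M) eq = cong₂ ℤ._+_ (eq 0) (sumBelowℤ-cong M (eq ∘ suc))

sumBelowℤ-zero : (M : ℕ) {f : ℕ → ℤ} → (∀ k → f k ≡ + 0) → sumBelowℤ M f ≡ + 0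
sumBelowℤ-zero zero    _  = refl
sumBelowℤ-zero (suc M) f0 = cong₂ ℤ._+_ (f0 0) (sumBelowℤ-zero M (f0 ∘ suc))

sumBelowℤ-+ : (M : ℕ) (f g : ℕ → ℤ) →
              sumBelowℤ M (λ k → f k ℤ.+ g k) ≡ sumBelowℤ M f ℤ.+ sumBelowℤ M g
sumBelowℤ-+ zero    f g = refl
sumBelowℤ-+ (suc M) f g =
  trans (cong (ℤ._+_ (f 0 ℤ.+ g 0)) (sumBelowℤ-+ M (f ∘ suc) (g ∘ suc))) (ℤ+-interchange (f 0) (g 0) _ _)

sumBelowℤ-neg : (M : ℕ) (f : ℕ → ℤ) → sumBelowℤ M (λ k → - f k) ≡ - sumBelowℤ M f
sumBelowℤ-neg zero    f = refl
sumBelowℤ-neg (suc M) f =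
  trans (cong (ℤ._+_ (- f 0)) (sumBelowℤ-neg M (f ∘ suc))) (sym (ℤ.neg-distrib-+ (f 0) _))

sumℤ-map-filter : (g : A → ℤ) (Q : A → Bool) (xs : List A) →
  sumℤ (map g (filter (λ x → T? (Q x)) xs)) ≡ sumℤ (map (λ x → if Q x then g x else + 0) xs)
sumℤ-map-filter g Q []       = refl
sumℤ-map-filter g Q (x ∷ xs) with Q x
... | true  = cong (ℤ._+_ (g x)) (sumℤ-map-filter g Q xs)
... | false = trans (sumℤ-map-filter g Q xs) (sym (ℤ.+-identityˡ _))

sumℤ-++ : (g : A → ℤ) (xs ys : List A) → sumℤ (map g (xs ++ ys)) ≡ sumℤ (map g xs) ℤ.+ sumℤ (map g ys)
sumℤ-++ g []       ys = sym (ℤ.+-identityˡ _)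
sumℤ-++ g (x ∷ xs) ys = trans (cong (ℤ._+_ (g x)) (sumℤ-++ g xs ys)) (sym (ℤ.+-assoc (g x) _ _))

sumℤ-concatMap-applyUpTo : (g : A → ℤ) (F : ℕ → List A) (f : ℕ → ℕ) (M : ℕ) →
  sumℤ (map g (concatMap F (applyUpTo f M))) ≡ sumBelowℤ M (λ k → sumℤ (map g (F (f k))))
sumℤ-concatMap-applyUpTo g F f zero    = refl
sumℤ-concatMap-applyUpTo g F f (suc M) =
  trans (sumℤ-++ g (F (f 0)) _) (cong (ℤ._+_ (sumℤ (map g (F (f 0))))) (sumℤ-concatMap-applyUpTo g F (f ∘ suc) M))

sumℤ-cong : (xs : List A) {g h : A → ℤ} → (∀ {x} → x ∈ xs → g x ≡ h x) →
            sumℤ (map g xs) ≡ sumℤ (map h xs)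
sumℤ-cong []       eq = refl
sumℤ-cong (x ∷ xs) eq = cong₂ ℤ._+_ (eq (here refl)) (sumℤ-cong xs (eq ∘ there))

sumℤ-*-∑ : (c : ℤ) (f : A → ℕ) (xs : List A) →
           sumℤ (map (λ x → c ℤ.* + f x) xs) ≡ c ℤ.* + sumOver xs f
sumℤ-*-∑ c f []       = sym (ℤ.*-zeroʳ c)
sumℤ-*-∑ c f (x ∷ xs) = begin
  c ℤ.* + f x ℤ.+ sumℤ (map (λ x → c ℤ.* + f x) xs) ≡⟨ cong (ℤ._+_ (c ℤ.* + f x)) (sumℤ-*-∑ c f xs) ⟩
  c ℤ.* + f x ℤ.+ c ℤ.* + sumOver xs f              ≡⟨ sym (ℤ.*-distribˡ-+ c (+ f x) _) ⟩
  c ℤ.* (+ f x ℤ.+ + sumOver xs f)                  ≡⟨ cong (c ℤ.*_) (sym (ℤ.pos-+ (f x) _)) ⟩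
  c ℤ.* + (f x + sumOver xs f)                      ∎

⊆-++-∉ : {x : A} (xs : List A) {ys zs : List A} → zs ⊆ xs ++ x ∷ ys → x ∉ zs → zs ⊆ xs ++ ys
⊆-++-∉ []       (_ ∷ʳ zs⊆) x∉ = zs⊆
⊆-++-∉ []       (refl ∷ _) x∉ = ⊥-elim (x∉ (here refl))
⊆-++-∉ (w ∷ xs) (_ ∷ʳ zs⊆) x∉ = w ∷ʳ ⊆-++-∉ xs zs⊆ x∉
⊆-++-∉ (w ∷ xs) (refl ∷ zs⊆) x∉ = refl ∷ ⊆-++-∉ xs zs⊆ (x∉ ∘ there)

Unique-⊆ : {xs ys : List A} → xs ⊆ ys → Unique ys → Unique xs
Unique-⊆ []         []        = []
Unique-⊆ (_ ∷ʳ xs⊆) (_ ∷ u)   = Unique-⊆ xs⊆ u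
Unique-⊆ (refl ∷ xs⊆) (x≢ ∷ u) = All-resp-⊆ xs⊆ x≢ ∷ Unique-⊆ xs⊆ u

unique-∷ : {x : A} {xs : List A} → x ∉ xs → Unique xs → Unique (x ∷ xs)
unique-∷ {xs = xs} x∉ u = ¬Any⇒All¬ xs x∉ ∷ u

∈-choose⁻ : ∀ k xs {S} → S ∈ choose k xs → S ⊆ xs × length S ≡ k
∈-choose⁻ zero    xs       (here refl) = []⊆-universal xs , refl
∈-choose⁻ (suc k) (x ∷ xs) S∈ with ∈-++⁻ (map (x ∷_) (choose k xs)) S∈
... | inj₂ S∈ʳ = let (S⊆ , len) = ∈-choose⁻ (suc k) xs S∈ʳ in x ∷ʳ S⊆ , len
... | inj₁ S∈ˡ with ∈-map⁻ (x ∷_) S∈ˡ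
...   | T , T∈ , refl = let (T⊆ , len) = ∈-choose⁻ k xs T∈ in refl ∷ T⊆ , cong suc len

∈-choose⁺ : ∀ {S xs} → S ⊆ xs → S ∈ choose (length S) xs
∈-choose⁺ [] = here refl
∈-choose⁺ {[]}    (y ∷ʳ _) = here refl
∈-choose⁺ {_ ∷ S} (y ∷ʳ S⊆) = ∈-++⁺ʳ (map (y ∷_) (choose (length S) _)) (∈-choose⁺ S⊆)
∈-choose⁺ (refl ∷ S⊆) = ∈-++⁺ˡ (∈-map⁺ _ (∈-choose⁺ S⊆))

choose-map : (f : ℕ → ℕ) (k : ℕ) (xs : List ℕ) → choose k (map f xs) ≡ map (map f) (choose k xs)
choose-map f zero    xs       = refl
choose-map f (suc k) []       = refl
choose-map f (suc k) (x ∷ xs) = begin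
  map (f x ∷_) (choose k (map f xs)) ++ choose (suc k) (map f xs)
    ≡⟨ cong₂ _++_ (cong (map (f x ∷_)) (choose-map f k xs)) (choose-map f (suc k) xs) ⟩
  map (f x ∷_) (map (map f) (choose k xs)) ++ map (map f) (choose (suc k) xs)
    ≡⟨ cong (_++ _) (trans (sym (map-∘ {g = f x ∷_} {f = map f} (choose k xs)))
                           (map-∘ {g = map f} {f = x ∷_} (choose k xs))) ⟩
  map (map f) (map (x ∷_) (choose k xs)) ++ map (map f) (choose (suc k) xs)
    ≡⟨ sym (map-++ (map f) (map (x ∷_) (choose k xs)) _) ⟩
  map (map f) (map (x ∷_) (choose k xs) ++ choose (suc k) xs) ∎

at-oneTo : (π : List ℕ) → map (at π) (oneTo (length π)) ≡ π
at-oneTo []       = refl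
at-oneTo (x ∷ xs) = cong (x ∷_) (begin
  map (at (x ∷ xs)) (map suc (applyUpTo suc n)) ≡⟨ cong (map (at (x ∷ xs))) (map-applyUpTo suc suc n) ⟩
  map (at (x ∷ xs)) (applyUpTo (suc ∘ suc) n)   ≡⟨ map-applyUpTo (suc ∘ suc) (at (x ∷ xs)) n ⟩
  applyUpTo (at xs ∘ suc) n                     ≡⟨ sym (map-applyUpTo suc (at xs) n) ⟩
  map (at xs) (applyUpTo suc n)                 ≡⟨ cong (map (at xs)) (sym (map-applyUpTo (λ i → i) suc n)) ⟩
  map (at xs) (oneTo n)                         ≡⟨ at-oneTo xs ⟩
  xs                                            ∎)
  where n = length xs

∈-oneTo⁺ : ∀ {i n} → 1 ≤ i → i ≤ n → i ∈ oneTo n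
∈-oneTo⁺ (s≤s _) i≤n = ∈-map⁺ suc (∈-upTo⁺ i≤n)

∈-oneTo⁻ : ∀ {n x} → x ∈ oneTo n → 1 ≤ x × x ≤ n
∈-oneTo⁻ x∈ with ∈-map⁻ suc x∈
... | _ , j∈ , refl = s≤s z≤n , ∈-upTo⁻ j∈

length-oneTo : ∀ n → length (oneTo n) ≡ n
length-oneTo n = trans (length-map suc (upTo n)) (length-upTo n)

Unique-oneTo : ∀ n → Unique (oneTo n)
Unique-oneTo n = Unique.map⁺ ℕ.suc-injective (Unique.upTo⁺ n)

-- Order isomorphism and embedding counts

sameOrder : ℕ → ℕ → ℕ × ℕ → Bool
sameOrder x y (x′ , y′) = ((x <ᵇ x′) ⇔ᵇ (y <ᵇ y′)) ∧ ((x′ <ᵇ x) ⇔ᵇ (y′ <ᵇ y))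

ordIso-length : ∀ xs ys → ordIso xs ys ≡ true → length xs ≡ length ys
ordIso-length []       []       _  = refl
ordIso-length (x ∷ xs) (y ∷ ys) xy = cong suc (ordIso-length xs ys (∧-true⁻ʳ xy))

allᵇ-sameOrder-sym : ∀ x y xs ys →
  allᵇ (sameOrder x y) (zip xs ys) ≡ allᵇ (sameOrder y x) (zip ys xs)
allᵇ-sameOrder-sym x y []         []         = refl
allᵇ-sameOrder-sym x y []         (_ ∷ _)    = refl
allᵇ-sameOrder-sym x y (_ ∷ _)    []         = refl
allᵇ-sameOrder-sym x y (x′ ∷ xs) (y′ ∷ ys) =
  cong₂ _∧_ (cong₂ _∧_ (⇔ᵇ-comm (x <ᵇ x′) _) (⇔ᵇ-comm (x′ <ᵇ x) _)) (allᵇ-sameOrder-sym x y xs ys)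

ordIso-sym : ∀ xs ys → ordIso xs ys ≡ ordIso ys xs
ordIso-sym []       []       = refl
ordIso-sym []       (_ ∷ _)  = refl
ordIso-sym (_ ∷ _)  []       = refl
ordIso-sym (x ∷ xs) (y ∷ ys) = cong₂ _∧_ (allᵇ-sameOrder-sym x y xs ys) (ordIso-sym xs ys)

allᵇ-sameOrder-trans : ∀ x y z xs ys zs → length xs ≡ length ys → length ys ≡ length zs →
  allᵇ (sameOrder x y) (zip xs ys) ≡ true → allᵇ (sameOrder y z) (zip ys zs) ≡ true →
  allᵇ (sameOrder x z) (zip xs zs) ≡ true
allᵇ-sameOrder-trans x y z []         []         []         _ _ _ _ = refl
allᵇ-sameOrder-trans x y z (x′ ∷ xs) (y′ ∷ ys) (z′ ∷ zs) xy yz xyA yzA =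
  ∧-true⁺ (∧-true⁺ (⇔ᵇ-trans (x <ᵇ x′) (y <ᵇ y′) (z <ᵇ z′) (∧-true⁻ˡ xy′) (∧-true⁻ˡ yz′))
                   (⇔ᵇ-trans (x′ <ᵇ x) (y′ <ᵇ y) (z′ <ᵇ z) (∧-true⁻ʳ xy′) (∧-true⁻ʳ yz′)))
          (allᵇ-sameOrder-trans x y z xs ys zs (ℕ.suc-injective xy) (ℕ.suc-injective yz)
                                (∧-true⁻ʳ xyA) (∧-true⁻ʳ yzA))
  where xy′ = ∧-true⁻ˡ xyA
        yz′ = ∧-true⁻ˡ yzA

ordIso-trans : ∀ xs ys zs → ordIso xs ys ≡ true → ordIso ys zs ≡ true → ordIso xs zs ≡ true
ordIso-trans []       []       []       _  _  = refl
ordIso-trans (x ∷ xs) (y ∷ ys) (z ∷ zs) xy yz =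
  ∧-true⁺ (allᵇ-sameOrder-trans x y z xs ys zs
             (ordIso-length xs ys (∧-true⁻ʳ xy)) (ordIso-length ys zs (∧-true⁻ʳ yz))
             (∧-true⁻ˡ xy) (∧-true⁻ˡ yz))
          (ordIso-trans xs ys zs (∧-true⁻ʳ xy) (∧-true⁻ʳ yz))

-- U and V are cut out of xs and ys at the same positions.
data Sublist₂ : List ℕ → List ℕ → List ℕ → List ℕ → Set where
  done : Sublist₂ [] [] [] []
  skip : ∀ {U V xs ys x y} → Sublist₂ U V xs ys → Sublist₂ U V (x ∷ xs) (y ∷ ys)
  keep : ∀ {U V xs ys x y} → Sublist₂ U V xs ys → Sublist₂ (x ∷ U) (y ∷ V) (x ∷ xs) (y ∷ ys)

Sublist₂-[] : ∀ xs ys → length xs ≡ length ys → Sublist₂ [] [] xs ys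
Sublist₂-[] []       []       _   = done
Sublist₂-[] (_ ∷ xs) (_ ∷ ys) len = skip (Sublist₂-[] xs ys (ℕ.suc-injective len))

allᵇ-Sublist₂ : (F : ℕ × ℕ → Bool) {U V xs ys : List ℕ} → Sublist₂ U V xs ys →
                allᵇ F (zip xs ys) ≡ true → allᵇ F (zip U V) ≡ true
allᵇ-Sublist₂ F done     _   = refl
allᵇ-Sublist₂ F (skip s) all = allᵇ-Sublist₂ F s (∧-true⁻ʳ all)
allᵇ-Sublist₂ F (keep s) all = ∧-true⁺ (∧-true⁻ˡ all) (allᵇ-Sublist₂ F s (∧-true⁻ʳ all))

ordIso-Sublist₂ : ∀ {U V xs ys} → Sublist₂ U V xs ys → ordIso xs ys ≡ true → ordIso U V ≡ true
ordIso-Sublist₂ done     _  = refl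
ordIso-Sublist₂ (skip s) xy = ordIso-Sublist₂ s (∧-true⁻ʳ xy)
ordIso-Sublist₂ {x ∷ _} {y ∷ _} (keep s) xy =
  ∧-true⁺ (allᵇ-Sublist₂ (sameOrder x y) s (∧-true⁻ˡ xy)) (ordIso-Sublist₂ s (∧-true⁻ʳ xy))

count-choose-∷ : (P : List ℕ → Bool) (k x : ℕ) (xs : List ℕ) →
  count P (choose (suc k) (x ∷ xs)) ≡ count (P ∘ (x ∷_)) (choose k xs) + count P (choose (suc k) xs)
count-choose-∷ P k x xs =
  trans (∑-++ (map (x ∷_) (choose k xs)) _ _) (cong (ℕ._+ _) (∑-map (x ∷_) (choose k xs) (iverson ∘ P)))

count-choose-Sublist₂ : ∀ k xs ys (P Q : List ℕ → Bool) → length xs ≡ length ys →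
  (∀ {U V} → Sublist₂ U V xs ys → P U ≡ Q V) → count P (choose k xs) ≡ count Q (choose k ys)
count-choose-Sublist₂ zero    xs       ys       P Q len PQ =
  cong (λ b → iverson b + 0) (PQ (Sublist₂-[] xs ys len))
count-choose-Sublist₂ (suc k) []       []       P Q len PQ = refl
count-choose-Sublist₂ (suc k) (x ∷ xs) (y ∷ ys) P Q len PQ = begin
  count P (choose (suc k) (x ∷ xs))
    ≡⟨ count-choose-∷ P k x xs ⟩
  count (P ∘ (x ∷_)) (choose k xs) + count P (choose (suc k) xs)
    ≡⟨ cong₂ _+_ (count-choose-Sublist₂ k xs ys _ _ len′ (PQ ∘ keep))
                 (count-choose-Sublist₂ (suc k) xs ys P Q len′ (PQ ∘ skip)) ⟩
  count (Q ∘ (y ∷_)) (choose k ys) + count Q (choose (suc k) ys)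
    ≡⟨ sym (count-choose-∷ Q k y ys) ⟩
  count Q (choose (suc k) (y ∷ ys)) ∎
  where len′ = ℕ.suc-injective len

E≡count-restrict : ∀ σ π →
  E σ π ≡ count (λ S → ordIso σ (map (at π) S)) (choose (length σ) (oneTo (length π)))
E≡count-restrict σ π =
  length-filter≡count (λ S → ordIso σ (map (at π) S)) (choose (length σ) (oneTo (length π)))

E≡count-choose : ∀ σ π → E σ π ≡ count (ordIso σ) (choose (length σ) π)
E≡count-choose σ π = begin
  E σ π
    ≡⟨ E≡count-restrict σ π ⟩
  count (ordIso σ ∘ map (at π)) (choose k positions)
    ≡⟨ sym (∑-map (map (at π)) (choose k positions) (iverson ∘ ordIso σ)) ⟩
  count (ordIso σ) (map (map (at π)) (choose k positions))
    ≡⟨ cong (count (ordIso σ)) (sym (choose-map (at π) k positions)) ⟩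
  count (ordIso σ) (choose k (map (at π) positions))
    ≡⟨ cong (count (ordIso σ) ∘ choose k) (at-oneTo π) ⟩
  count (ordIso σ) (choose k π) ∎
  where
    k = length σ
    positions = oneTo (length π)

E-resp-ordIso : ∀ σ {τ w} → ordIso τ w ≡ true → E σ τ ≡ E σ w
E-resp-ordIso σ {τ} {w} τ≅w = begin
  E σ τ                             ≡⟨ E≡count-choose σ τ ⟩
  count (ordIso σ) (choose k τ)     ≡⟨ count-choose-Sublist₂ k τ w _ _ (ordIso-length τ w τ≅w) same ⟩
  count (ordIso σ) (choose k w)     ≡⟨ sym (E≡count-choose σ w) ⟩
  E σ w                             ∎
  where
    k = length σ
    same : ∀ {U V} → Sublist₂ U V τ w → ordIso σ U ≡ ordIso σ V
    same {U} {V} s = ≡true-ext (λ σ≅U → ordIso-trans σ U V σ≅U U≅V)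
                               (λ σ≅V → ordIso-trans σ V U σ≅V (trans (ordIso-sym V U) U≅V))
      where U≅V = ordIso-Sublist₂ s τ≅w

infixl 9 _↾_
_↾_ : List ℕ → List ℕ → List ℕ
π ↾ S = map (at π) S

Unique-↾ : ∀ π {S} → Unique π → S ⊆ oneTo (length π) → Unique (π ↾ S)
Unique-↾ π u S⊆ = Unique-⊆ (subst (π ↾ _ ⊆_) (at-oneTo π) (⊆-map⁺ (at π) S⊆)) u

E-↾ : ∀ σ π S → E σ (π ↾ S) ≡ count (λ U → ordIso σ (π ↾ U)) (choose (length σ) S)
E-↾ σ π S = begin
  E σ (π ↾ S)                                              ≡⟨ E≡count-choose σ (π ↾ S) ⟩
  count (ordIso σ) (choose k (π ↾ S))                      ≡⟨ cong (count (ordIso σ)) (choose-map (at π) k S) ⟩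
  count (ordIso σ) (map (map (at π)) (choose k S))         ≡⟨ ∑-map (map (at π)) (choose k S) (iverson ∘ ordIso σ) ⟩
  count (λ U → ordIso σ (π ↾ U)) (choose k S)              ∎
  where k = length σ

≤ᵇP-↾⁺ : ∀ σ π {S U} → U ⊆ S → length U ≡ length σ → ordIso σ (π ↾ U) ≡ true →
         (σ ≤ᵇP (π ↾ S)) ≡ true
≤ᵇP-↾⁺ σ π {S} {U} U⊆ len σ≅ = subst (λ e → (0 <ᵇ e) ≡ true) (sym (E-↾ σ π S))
  (count-pos⁺ (λ U → ordIso σ (π ↾ U)) (choose (length σ) S)
               (subst (λ k → U ∈ choose k S) len (∈-choose⁺ U⊆)) σ≅)

≤ᵇP-↾⁻ : ∀ σ π S → (σ ≤ᵇP (π ↾ S)) ≡ true →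
         ∃ λ U → U ⊆ S × length U ≡ length σ × ordIso σ (π ↾ U) ≡ true
≤ᵇP-↾⁻ σ π S σ≤ =
  let (U , U∈ , σ≅) = count-pos⁻ (λ U → ordIso σ (π ↾ U)) (choose (length σ) S)
                                 (subst (λ e → (0 <ᵇ e) ≡ true) (E-↾ σ π S) σ≤)
      (U⊆ , len) = ∈-choose⁻ (length σ) S U∈
  in U , U⊆ , len , σ≅

∈-embeddings⁺ : ∀ σ π {U} → U ⊆ oneTo (length π) → length U ≡ length σ → ordIso σ (π ↾ U) ≡ true →
                U ∈ embeddings σ π
∈-embeddings⁺ σ π {U} U⊆ len σ≅ = ∈-filter⁺ (λ S → T? (ordIso σ (π ↾ S)))
  (subst (λ k → U ∈ choose k (oneTo (length π))) len (∈-choose⁺ U⊆)) (subst T (sym σ≅) tt)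

-- A list of distinct values has exactly one pattern

insertAt : ℕ → ℕ → List ℕ → List ℕ
insertAt zero    v xs       = v ∷ xs
insertAt (suc p) v []       = v ∷ []
insertAt (suc p) v (x ∷ xs) = x ∷ insertAt p v xs

-- 0-based lookup, with junk value 0 out of range
_‼_ : List ℕ → ℕ → ℕ
[]       ‼ _     = 0
(y ∷ ys) ‼ zero  = y
(y ∷ ys) ‼ suc p = ys ‼ p

deleteAt : ℕ → List ℕ → List ℕ
deleteAt _       []       = []
deleteAt zero    (y ∷ ys) = ys
deleteAt (suc p) (y ∷ ys) = y ∷ deleteAt p ys

maxAt : ℕ → List ℕ → Bool
maxAt p w = allᵇ (λ z → z <ᵇ w ‼ p) (deleteAt p w)

‼-∈ : ∀ p ys → p < length ys → ys ‼ p ∈ ys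
‼-∈ zero    (y ∷ ys) _         = here refl
‼-∈ (suc p) (y ∷ ys) (s≤s p<) = there (‼-∈ p ys p<)

∈-‼-deleteAt : ∀ p {z} ys → z ∈ ys → z ≡ ys ‼ p ⊎ z ∈ deleteAt p ys
∈-‼-deleteAt zero    (y ∷ ys) (here refl) = inj₁ refl
∈-‼-deleteAt zero    (y ∷ ys) (there z∈)  = inj₂ z∈
∈-‼-deleteAt (suc p) (y ∷ ys) (here refl) = inj₂ (here refl)
∈-‼-deleteAt (suc p) (y ∷ ys) (there z∈) with ∈-‼-deleteAt p ys z∈
... | inj₁ z≡ = inj₁ z≡
... | inj₂ z∈′ = inj₂ (there z∈′)

deleteAt-⊆ : ∀ p ys → deleteAt p ys ⊆ ys
deleteAt-⊆ p       []       = []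
deleteAt-⊆ zero    (y ∷ ys) = y ∷ʳ ⊆-refl
deleteAt-⊆ (suc p) (y ∷ ys) = refl ∷ deleteAt-⊆ p ys

length-deleteAt : ∀ p ys → p < length ys → suc (length (deleteAt p ys)) ≡ length ys
length-deleteAt zero    (y ∷ ys) _         = refl
length-deleteAt (suc p) (y ∷ ys) (s≤s p<) = cong suc (length-deleteAt p ys p<)

count-insertAll : (P : List ℕ → Bool) (v : ℕ) (ρ : List ℕ) →
  count P (insertAll v ρ) ≡ sumBelow (suc (length ρ)) (λ p → iverson (P (insertAt p v ρ)))
count-insertAll P v []       = refl
count-insertAll P v (x ∷ xs) = cong (iverson (P (v ∷ x ∷ xs)) ℕ.+_)
  (trans (∑-map (x ∷_) (insertAll v xs) (iverson ∘ P)) (count-insertAll (P ∘ (x ∷_)) v xs))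

sameOrder-from-max : ∀ v y x′ y′ → (x′ <ᵇ v) ≡ true → sameOrder v y (x′ , y′) ≡ (y′ <ᵇ y)
sameOrder-from-max v y x′ y′ x′<v rewrite <ᵇ-asym x′ v x′<v | x′<v with y′ <ᵇ y in y′<y
... | true rewrite <ᵇ-asym y′ y y′<y = refl
... | false = ∧-zeroʳ _

sameOrder-to-max : ∀ x y v g → (x <ᵇ v) ≡ true → sameOrder x y (v , g) ≡ (y <ᵇ g)
sameOrder-to-max x y v g x<v rewrite <ᵇ-asym x v x<v | x<v with y <ᵇ g in y<g
... | true rewrite <ᵇ-asym y g y<g = refl
... | false = refl

allᵇ-sameOrder-from-max : ∀ v y ρ ys → length ρ ≡ length ys → allᵇ (λ x → x <ᵇ v) ρ ≡ true →
  allᵇ (sameOrder v y) (zip ρ ys) ≡ allᵇ (λ z → z <ᵇ y) ys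
allᵇ-sameOrder-from-max v y []       []        _   _    = refl
allᵇ-sameOrder-from-max v y (x ∷ ρ) (y′ ∷ ys) len ρ<v =
  cong₂ _∧_ (sameOrder-from-max v y x y′ (∧-true⁻ˡ ρ<v))
            (allᵇ-sameOrder-from-max v y ρ ys (ℕ.suc-injective len) (∧-true⁻ʳ ρ<v))

allᵇ-zip-insertAt : (F : ℕ × ℕ → Bool) (p v : ℕ) (xs ys : List ℕ) →
  p ≤ length xs → length ys ≡ suc (length xs) →
  allᵇ F (zip (insertAt p v xs) ys) ≡ F (v , ys ‼ p) ∧ allᵇ F (zip xs (deleteAt p ys))
allᵇ-zip-insertAt F zero    v xs       (y ∷ ys) _         _   = refl
allᵇ-zip-insertAt F (suc p) v (x ∷ xs) (y ∷ ys) (s≤s p≤) len =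
  trans (cong (F (x , y) ∧_) (allᵇ-zip-insertAt F p v xs ys p≤ (ℕ.suc-injective len)))
        (∧-left-comm (F (x , y)) (F (v , ys ‼ p)) _)

ordIso-insertAt : ∀ p v ρ w → p ≤ length ρ → length w ≡ suc (length ρ) →
  allᵇ (λ x → x <ᵇ v) ρ ≡ true → ordIso (insertAt p v ρ) w ≡ maxAt p w ∧ ordIso ρ (deleteAt p w)
ordIso-insertAt zero v ρ (y ∷ ys) _ len ρ<v =
  cong (_∧ ordIso ρ ys) (allᵇ-sameOrder-from-max v y ρ ys (sym (ℕ.suc-injective len)) ρ<v)
ordIso-insertAt (suc p) v (x ∷ xs) (y ∷ ys) (s≤s p≤) len ρ<v = begin
  allᵇ (sameOrder x y) (zip (insertAt p v xs) ys) ∧ ordIso (insertAt p v xs) ys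
    ≡⟨ cong₂ _∧_ (allᵇ-zip-insertAt (sameOrder x y) p v xs ys p≤ len′)
                 (ordIso-insertAt p v xs ys p≤ len′ (∧-true⁻ʳ ρ<v)) ⟩
  (sameOrder x y (v , ys ‼ p) ∧ headOrder) ∧ (maxAt p ys ∧ tailIso)
    ≡⟨ cong (λ b → (b ∧ headOrder) ∧ (maxAt p ys ∧ tailIso)) (sameOrder-to-max x y v (ys ‼ p) (∧-true⁻ˡ ρ<v)) ⟩
  ((y <ᵇ ys ‼ p) ∧ headOrder) ∧ (maxAt p ys ∧ tailIso)
    ≡⟨ ∧-interchange (y <ᵇ ys ‼ p) headOrder (maxAt p ys) tailIso ⟩
  ((y <ᵇ ys ‼ p) ∧ maxAt p ys) ∧ (headOrder ∧ tailIso) ∎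
  where
    len′ = ℕ.suc-injective len
    headOrder = allᵇ (sameOrder x y) (zip xs (deleteAt p ys))
    tailIso = ordIso xs (deleteAt p ys)

count-maxAt≡1 : ∀ y ys → Unique (y ∷ ys) → sumBelow (suc (length ys)) (λ p → iverson (maxAt p (y ∷ ys))) ≡ 1
count-maxAt≡1 y []         _ = refl
count-maxAt≡1 y zs@(_ ∷ _) u@(_ ∷ u′) with allᵇ (λ z → z <ᵇ y) zs in y-max
... | true = cong suc (trans (sumBelow-cong (length zs) not-beyond-y) (sumBelow-zero (length zs)))
  where
    not-beyond-y : ∀ {p} → p < length zs → iverson ((y <ᵇ zs ‼ p) ∧ maxAt p zs) ≡ 0
    not-beyond-y {p} p< rewrite <ᵇ-asym (zs ‼ p) y (allᵇ-∈ (λ z → z <ᵇ y) zs y-max (‼-∈ p zs p<)) = refl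
... | false = trans (sumBelow-cong (length zs) (cong iverson ∘ ∧-absorbˡ ∘ below-max))
                    (count-maxAt≡1 _ _ u′)
  where
    witness = allᵇ-false⁻ (λ z → z <ᵇ y) zs y-max
    z = proj₁ witness
    z∈ = proj₁ (proj₂ witness)
    y<z : y < z
    y<z = ℕ.≤∧≢⇒< (<ᵇ-false⇒≥ z y (proj₂ (proj₂ witness)))
                  λ y≡z → Unique[x∷xs]⇒x∉xs u (subst (_∈ zs) (sym y≡z) z∈)
    below-max : ∀ {p} → p < length zs → maxAt p zs ≡ true → (y <ᵇ zs ‼ p) ≡ true
    below-max {p} _ max with ∈-‼-deleteAt p zs z∈
    ... | inj₁ z≡ = <⇒<ᵇ-true (subst (y <_) z≡ y<z)
    ... | inj₂ z∈′ = <⇒<ᵇ-true (ℕ.<-trans y<z (<ᵇ-true⇒< z (zs ‼ p) (allᵇ-∈ _ (deleteAt p zs) max z∈′)))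

allᵇ-<-suc : ∀ b xs → allᵇ (λ x → x <ᵇ b) xs ≡ true → allᵇ (λ x → x <ᵇ suc b) xs ≡ true
allᵇ-<-suc b []       _   = refl
allᵇ-<-suc b (x ∷ xs) all =
  ∧-true⁺ (<⇒<ᵇ-true (ℕ.m<n⇒m<1+n (<ᵇ-true⇒< x b (∧-true⁻ˡ all)))) (allᵇ-<-suc b xs (∧-true⁻ʳ all))

∈-insertAll⁻ : ∀ v ρ {τ} → τ ∈ insertAll v ρ → allᵇ (λ x → x <ᵇ v) ρ ≡ true →
               length τ ≡ suc (length ρ) × allᵇ (λ x → x <ᵇ suc v) τ ≡ true
∈-insertAll⁻ v []       (here refl) ρ<v = refl , ∧-true⁺ (<⇒<ᵇ-true (ℕ.n<1+n v)) refl
∈-insertAll⁻ v (x ∷ xs) (here refl) ρ<v =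
  refl , ∧-true⁺ (<⇒<ᵇ-true (ℕ.n<1+n v)) (allᵇ-<-suc v (x ∷ xs) ρ<v)
∈-insertAll⁻ v (x ∷ xs) (there τ∈) ρ<v with ∈-map⁻ (x ∷_) τ∈
... | τ′ , τ′∈ , refl =
  let (len , τ′<) = ∈-insertAll⁻ v xs τ′∈ (∧-true⁻ʳ ρ<v)
  in cong suc len , ∧-true⁺ (∧-true⁻ˡ (allᵇ-<-suc v (x ∷ xs) ρ<v)) τ′<

∈-allPerms⁻ : ∀ k {ρ} → ρ ∈ allPerms k → length ρ ≡ k × allᵇ (λ x → x <ᵇ suc k) ρ ≡ true
∈-allPerms⁻ zero    (here refl) = refl , refl
∈-allPerms⁻ (suc k) ρ∈ with ∈-concat⁻′ (map (insertAll (suc k)) (allPerms k)) ρ∈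
... | _ , ρ∈ρs , ρs∈ with ∈-map⁻ (insertAll (suc k)) ρs∈
...   | ρ′ , ρ′∈ , refl =
  let (len′ , ρ′<) = ∈-allPerms⁻ k ρ′∈
      (len , ρ<) = ∈-insertAll⁻ (suc k) ρ′ ρ∈ρs ρ′<
  in trans len (cong suc len′) , ρ<

-- allPerms inserts the maximum at every position, and only the position of the maximum of w
-- can match; the rest is the induction hypothesis.
count-ordIso-allPerms≡1 : ∀ k w → Unique w → length w ≡ k → count (λ τ → ordIso τ w) (allPerms k) ≡ 1
count-ordIso-allPerms≡1 zero    []         _ _   = refl
count-ordIso-allPerms≡1 (suc k) w@(y ∷ ys) u len = begin
  count (λ τ → ordIso τ w) (concatMap (insertAll (suc k)) (allPerms k))
    ≡⟨ ∑-concatMap (insertAll (suc k)) (allPerms k) _ ⟩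
  ∑[ ρ ← allPerms k ] count (λ τ → ordIso τ w) (insertAll (suc k) ρ)
    ≡⟨ ∑-cong (allPerms k) insert-max ⟩
  ∑[ ρ ← allPerms k ] sumBelow (suc k) (λ p → iverson (maxAt p w ∧ ordIso ρ (deleteAt p w)))
    ≡⟨ ∑-sumBelow-comm (allPerms k) (suc k) (λ ρ p → iverson (maxAt p w ∧ ordIso ρ (deleteAt p w))) ⟩
  sumBelow (suc k) (λ p → count (λ ρ → maxAt p w ∧ ordIso ρ (deleteAt p w)) (allPerms k))
    ≡⟨ sumBelow-cong (suc k) delete-max ⟩
  sumBelow (suc k) (λ p → iverson (maxAt p w))
    ≡⟨ subst (λ L → sumBelow L (λ p → iverson (maxAt p w)) ≡ 1) len (count-maxAt≡1 y ys u) ⟩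
  1 ∎
  where
    insert-max : ∀ {ρ} → ρ ∈ allPerms k → count (λ τ → ordIso τ w) (insertAll (suc k) ρ) ≡
                 sumBelow (suc k) (λ p → iverson (maxAt p w ∧ ordIso ρ (deleteAt p w)))
    insert-max {ρ} ρ∈ = let (lenρ , ρ<) = ∈-allPerms⁻ k ρ∈ in begin
      count (λ τ → ordIso τ w) (insertAll (suc k) ρ)
        ≡⟨ count-insertAll (λ τ → ordIso τ w) (suc k) ρ ⟩
      sumBelow (suc (length ρ)) (λ p → iverson (ordIso (insertAt p (suc k) ρ) w))
        ≡⟨ sumBelow-cong (suc (length ρ)) (λ {p} p< → cong iverson
             (ordIso-insertAt p (suc k) ρ w (ℕ.s≤s⁻¹ p<) (trans len (cong suc (sym lenρ))) ρ<)) ⟩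
      sumBelow (suc (length ρ)) (λ p → iverson (maxAt p w ∧ ordIso ρ (deleteAt p w)))
        ≡⟨ cong (λ L → sumBelow (suc L) (λ p → iverson (maxAt p w ∧ ordIso ρ (deleteAt p w)))) lenρ ⟩
      sumBelow (suc k) (λ p → iverson (maxAt p w ∧ ordIso ρ (deleteAt p w))) ∎
    delete-max : ∀ {p} → p < suc k →
                 count (λ ρ → maxAt p w ∧ ordIso ρ (deleteAt p w)) (allPerms k) ≡ iverson (maxAt p w)
    delete-max {p} p< = begin
      count (λ ρ → maxAt p w ∧ ordIso ρ (deleteAt p w)) (allPerms k)
        ≡⟨ sym (iverson-*-count (maxAt p w) (λ ρ → ordIso ρ (deleteAt p w)) (allPerms k)) ⟩
      iverson (maxAt p w) * count (λ ρ → ordIso ρ (deleteAt p w)) (allPerms k)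
        ≡⟨ cong (iverson (maxAt p w) *_) (count-ordIso-allPerms≡1 k (deleteAt p w)
             (Unique-⊆ (deleteAt-⊆ p w) u)
             (ℕ.suc-injective (trans (length-deleteAt p w (subst (p <_) (sym len) p<)) len))) ⟩
      iverson (maxAt p w) * 1
        ≡⟨ ℕ.*-identityʳ _ ⟩
      iverson (maxAt p w) ∎

-- Alternating sums over sublists

-- alternatingSum P xs = Σ over sublists S of xs of (-1)^|S| [P S].
alternatingSum : (List A → Bool) → List A → ℤ
alternatingSum P []       = + iverson (P [])
alternatingSum P (x ∷ xs) = - alternatingSum (P ∘ (x ∷_)) xs ℤ.+ alternatingSum P xs

alternatingSum-cong : (xs : List A) {P Q : List A → Bool} → (∀ {S} → S ⊆ xs → P S ≡ Q S) →
                      alternatingSum P xs ≡ alternatingSum Q xs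
alternatingSum-cong []       PQ = cong (+_ ∘ iverson) (PQ [])
alternatingSum-cong (x ∷ xs) PQ = cong₂ (λ a b → - a ℤ.+ b)
  (alternatingSum-cong xs (PQ ∘ (refl ∷_))) (alternatingSum-cong xs (PQ ∘ (x ∷ʳ_)))

-- Toggling membership of i is a sign-reversing involution on the sublists.
alternatingSum-insensitive≡0 : (pre post : List A) (i : A) (P : List A → Bool) →
  (∀ {S T} → S ⊆ pre → T ⊆ post → P (S ++ T) ≡ P (S ++ i ∷ T)) →
  alternatingSum P (pre ++ i ∷ post) ≡ + 0
alternatingSum-insensitive≡0 []        post i P insensitive =
  trans (cong (λ a → - a ℤ.+ alternatingSum P post)
              (alternatingSum-cong post (sym ∘ insensitive [])))
        (ℤ.+-inverseˡ (alternatingSum P post))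
alternatingSum-insensitive≡0 (a ∷ pre) post i P insensitive = cong₂ (λ u v → - u ℤ.+ v)
  (alternatingSum-insensitive≡0 pre post i (P ∘ (a ∷_)) (λ S⊆ T⊆ → insensitive (refl ∷ S⊆) T⊆))
  (alternatingSum-insensitive≡0 pre post i P (λ S⊆ T⊆ → insensitive (a ∷ʳ S⊆) T⊆))

sign-suc-+ : ∀ k m n → sign (suc k) ℤ.* + (m + n) ≡ - (sign k ℤ.* + m) ℤ.+ sign (suc k) ℤ.* + n
sign-suc-+ k m n = begin
  sign (suc k) ℤ.* + (m + n)                         ≡⟨ cong (sign (suc k) ℤ.*_) (ℤ.pos-+ m n) ⟩
  sign (suc k) ℤ.* (+ m ℤ.+ + n)                     ≡⟨ ℤ.*-distribˡ-+ (sign (suc k)) (+ m) (+ n) ⟩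
  sign (suc k) ℤ.* + m ℤ.+ sign (suc k) ℤ.* + n      ≡⟨ cong (ℤ._+ _) (sym (ℤ.neg-distribˡ-* (sign k) (+ m))) ⟩
  - (sign k ℤ.* + m) ℤ.+ sign (suc k) ℤ.* + n        ∎

alternatingSum-choose : (xs : List ℕ) (P : List ℕ → Bool) (M : ℕ) → length xs < M →
  sumBelowℤ M (λ k → sign k ℤ.* + count P (choose k xs)) ≡ alternatingSum P xs
alternatingSum-choose [] P (suc M) _ = begin
  sign 0 ℤ.* + (iverson (P []) + 0) ℤ.+ sumBelowℤ M (λ k → sign (suc k) ℤ.* + 0)
    ≡⟨ cong₂ ℤ._+_ (trans (ℤ.*-identityˡ _) (cong +_ (ℕ.+-identityʳ _)))
                   (sumBelowℤ-zero M (λ k → ℤ.*-zeroʳ (sign (suc k)))) ⟩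
  + iverson (P []) ℤ.+ + 0
    ≡⟨ ℤ.+-identityʳ _ ⟩
  + iverson (P []) ∎
alternatingSum-choose (x ∷ xs) P (suc M) (s≤s |xs|<M) = begin
  s₀ ℤ.+ sumBelowℤ M (λ k → sign (suc k) ℤ.* + count P (choose (suc k) (x ∷ xs)))
    ≡⟨ cong (ℤ._+_ s₀) (sumBelowℤ-cong M λ k →
         trans (cong (λ c → sign (suc k) ℤ.* + c) (count-choose-∷ P k x xs)) (sign-suc-+ k _ _)) ⟩
  s₀ ℤ.+ sumBelowℤ M (λ k → - (sign k ℤ.* + count (P ∘ (x ∷_)) (choose k xs)) ℤ.+ rest k)
    ≡⟨ cong (ℤ._+_ s₀) (trans (sumBelowℤ-+ M _ rest) (cong (ℤ._+ sumBelowℤ M rest) (sumBelowℤ-neg M _))) ⟩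
  s₀ ℤ.+ (- sumBelowℤ M (λ k → sign k ℤ.* + count (P ∘ (x ∷_)) (choose k xs)) ℤ.+ sumBelowℤ M rest)
    ≡⟨ cong (λ a → s₀ ℤ.+ (- a ℤ.+ sumBelowℤ M rest)) (alternatingSum-choose xs (P ∘ (x ∷_)) M |xs|<M) ⟩
  s₀ ℤ.+ (- alternatingSum (P ∘ (x ∷_)) xs ℤ.+ sumBelowℤ M rest)
    ≡⟨ ℤ+-left-comm s₀ (- alternatingSum (P ∘ (x ∷_)) xs) (sumBelowℤ M rest) ⟩
  - alternatingSum (P ∘ (x ∷_)) xs ℤ.+ (s₀ ℤ.+ sumBelowℤ M rest)
    ≡⟨ cong (ℤ._+_ (- alternatingSum (P ∘ (x ∷_)) xs))
            (alternatingSum-choose xs P (suc M) (ℕ.m<n⇒m<1+n |xs|<M)) ⟩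
  - alternatingSum (P ∘ (x ∷_)) xs ℤ.+ alternatingSum P xs ∎
  where
    s₀ = sign 0 ℤ.* + count P (choose 0 xs)
    rest : ℕ → ℤ
    rest k = sign (suc k) ℤ.* + count P (choose (suc k) xs)

-- The test τ ≤ π in the interval sum is redundant: E τ π = 0 when it fails.
intervalTerm≡ : ∀ σ τ π (s : ℤ) →
  (if (σ ≤ᵇP τ) ∧ (τ ≤ᵇP π) then s ℤ.* + E τ π else + 0) ≡ s ℤ.* + (iverson (σ ≤ᵇP τ) * E τ π)
intervalTerm≡ σ τ π s with σ ≤ᵇP τ | τ ≤ᵇP π in τ≤π
... | false | _     = sym (ℤ.*-zeroʳ s)
... | true  | true  = cong (λ e → s ℤ.* + e) (sym (ℕ.+-identityʳ (E τ π)))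
... | true  | false rewrite ℕ.n≤0⇒n≡0 (<ᵇ-false⇒≥ 0 (E τ π) τ≤π) = sym (ℤ.*-zeroʳ s)

count-allPerms-≤ᵇP : ∀ σ k w → Unique w → length w ≡ k →
  count (λ τ → (σ ≤ᵇP τ) ∧ ordIso τ w) (allPerms k) ≡ iverson (σ ≤ᵇP w)
count-allPerms-≤ᵇP σ k w u len = begin
  count (λ τ → (σ ≤ᵇP τ) ∧ ordIso τ w) (allPerms k)
    ≡⟨ ∑-cong (allPerms k) (λ {τ} _ → cong iverson (via-pattern τ)) ⟩
  count (λ τ → (σ ≤ᵇP w) ∧ ordIso τ w) (allPerms k)
    ≡⟨ sym (iverson-*-count (σ ≤ᵇP w) (λ τ → ordIso τ w) (allPerms k)) ⟩
  iverson (σ ≤ᵇP w) * count (λ τ → ordIso τ w) (allPerms k)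
    ≡⟨ cong (iverson (σ ≤ᵇP w) *_) (count-ordIso-allPerms≡1 k w u len) ⟩
  iverson (σ ≤ᵇP w) * 1
    ≡⟨ ℕ.*-identityʳ _ ⟩
  iverson (σ ≤ᵇP w) ∎
  where
    via-pattern : ∀ τ → (σ ≤ᵇP τ) ∧ ordIso τ w ≡ (σ ≤ᵇP w) ∧ ordIso τ w
    via-pattern τ with ordIso τ w in τ≅w
    ... | true  = cong (λ e → (0 <ᵇ e) ∧ true) (E-resp-ordIso σ {τ} {w} τ≅w)
    ... | false = trans (∧-zeroʳ _) (sym (∧-zeroʳ _))

intervalSum-allPerms : ∀ σ π k → Unique π →
  sumℤ (map (λ τ → if (σ ≤ᵇP τ) ∧ (τ ≤ᵇP π) then sign (length τ) ℤ.* + E τ π else + 0) (allPerms k))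
  ≡ sign k ℤ.* + count (λ S → σ ≤ᵇP (π ↾ S)) (choose k (oneTo (length π)))
intervalSum-allPerms σ π k u = begin
  sumℤ (map (λ τ → if (σ ≤ᵇP τ) ∧ (τ ≤ᵇP π) then sign (length τ) ℤ.* + E τ π else + 0) (allPerms k))
    ≡⟨ sumℤ-cong (allPerms k) (λ {τ} τ∈ → trans (intervalTerm≡ σ τ π (sign (length τ)))
         (cong (λ l → sign l ℤ.* + (iverson (σ ≤ᵇP τ) * E τ π)) (proj₁ (∈-allPerms⁻ k τ∈)))) ⟩
  sumℤ (map (λ τ → sign k ℤ.* + (iverson (σ ≤ᵇP τ) * E τ π)) (allPerms k))
    ≡⟨ sumℤ-*-∑ (sign k) _ (allPerms k) ⟩
  sign k ℤ.* + (∑[ τ ← allPerms k ] iverson (σ ≤ᵇP τ) * E τ π)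
    ≡⟨ cong (λ e → sign k ℤ.* + e) (begin
         ∑[ τ ← allPerms k ] iverson (σ ≤ᵇP τ) * E τ π
           ≡⟨ ∑-cong (allPerms k) (λ {τ} τ∈ → embeddings-by-subset τ (proj₁ (∈-allPerms⁻ k τ∈))) ⟩
         ∑[ τ ← allPerms k ] ∑[ S ← subsets ] iverson ((σ ≤ᵇP τ) ∧ ordIso τ (π ↾ S))
           ≡⟨ ∑-comm (allPerms k) subsets _ ⟩
         ∑[ S ← subsets ] count (λ τ → (σ ≤ᵇP τ) ∧ ordIso τ (π ↾ S)) (allPerms k)
           ≡⟨ ∑-cong subsets (λ {S} S∈ → let (S⊆ , len) = ∈-choose⁻ k _ S∈ in
                count-allPerms-≤ᵇP σ k (π ↾ S) (Unique-↾ π u S⊆) (trans (length-map (at π) S) len)) ⟩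
         count (λ S → σ ≤ᵇP (π ↾ S)) subsets ∎) ⟩
  sign k ℤ.* + count (λ S → σ ≤ᵇP (π ↾ S)) subsets ∎
  where
    subsets = choose k (oneTo (length π))
    embeddings-by-subset : ∀ τ → length τ ≡ k →
      iverson (σ ≤ᵇP τ) * E τ π ≡ ∑[ S ← subsets ] iverson ((σ ≤ᵇP τ) ∧ ordIso τ (π ↾ S))
    embeddings-by-subset τ refl = trans (cong (iverson (σ ≤ᵇP τ) *_) (E≡count-restrict τ π))
                                        (iverson-*-count (σ ≤ᵇP τ) (λ S → ordIso τ (π ↾ S)) subsets)

intervalSum≡alternatingSum : ∀ σ π → Unique π →
  intervalSum σ π ≡ alternatingSum (λ S → σ ≤ᵇP (π ↾ S)) (oneTo (length π))
intervalSum≡alternatingSum σ π u = begin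
  intervalSum σ π
    ≡⟨ sumℤ-map-filter (λ τ → sign (length τ) ℤ.* + E τ π) (λ τ → (σ ≤ᵇP τ) ∧ (τ ≤ᵇP π))
                       (permsBelow (suc N)) ⟩
  sumℤ (map term (concatMap allPerms (upTo (suc N))))
    ≡⟨ sumℤ-concatMap-applyUpTo term allPerms (λ k → k) (suc N) ⟩
  sumBelowℤ (suc N) (λ k → sumℤ (map term (allPerms k)))
    ≡⟨ sumBelowℤ-cong (suc N) (λ k → intervalSum-allPerms σ π k u) ⟩
  sumBelowℤ (suc N) (λ k → sign k ℤ.* + count P (choose k (oneTo N)))
    ≡⟨ alternatingSum-choose (oneTo N) P (suc N) (s≤s (ℕ.≤-reflexive (length-oneTo N))) ⟩
  alternatingSum P (oneTo N) ∎
  where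
    N = length π
    P = λ S → σ ≤ᵇP (π ↾ S)
    term : List ℕ → ℤ
    term τ = if (σ ≤ᵇP τ) ∧ (τ ≤ᵇP π) then sign (length τ) ℤ.* + E τ π else + 0

omits⇒intervalSum≡0 : ∀ σ π i → Unique π → 1 ≤ i → i ≤ length π → Omits σ π i →
                      intervalSum σ π ≡ + 0
omits⇒intervalSum≡0 σ π i u 1≤i i≤N omits with ∈-∃++ (∈-oneTo⁺ 1≤i i≤N)
... | pre , post , positions = begin
  intervalSum σ π                       ≡⟨ intervalSum≡alternatingSum σ π u ⟩
  alternatingSum P (oneTo (length π))   ≡⟨ cong (alternatingSum P) positions ⟩
  alternatingSum P (pre ++ i ∷ post)    ≡⟨ alternatingSum-insensitive≡0 pre post i P insensitive ⟩
  + 0                                   ∎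
  where
    P = λ S → σ ≤ᵇP (π ↾ S)
    insensitive : ∀ {S T} → S ⊆ pre → T ⊆ post → P (S ++ T) ≡ P (S ++ i ∷ T)
    insensitive {S} {T} S⊆ T⊆ = ≡true-ext
      (λ σ≤ → let (U , U⊆ , len , σ≅) = ≤ᵇP-↾⁻ σ π (S ++ T) σ≤
              in ≤ᵇP-↾⁺ σ π (⊆-trans U⊆ (++⁺ (⊆-refl {x = S}) (i ∷ʳ ⊆-refl))) len σ≅)
      (λ σ≤ → let (U , U⊆ , len , σ≅) = ≤ᵇP-↾⁻ σ π (S ++ i ∷ T) σ≤
                  U⊆π = subst (U ⊆_) (sym positions) (⊆-trans U⊆ (++⁺ S⊆ (refl ∷ T⊆)))
              in ≤ᵇP-↾⁺ σ π (⊆-++-∉ S U⊆ (omits U (∈-embeddings⁺ σ π U⊆π len σ≅))) len σ≅)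

omits⇒vanishing : ∀ σ π i → Unique π → 1 ≤ i → i ≤ length π → Omits σ π i → Vanishing σ π
omits⇒vanishing σ π i u 1≤i i≤N omits =
  trans (cong (μ (2 ∷ 1 ∷ []) σ ℤ.*_) (omits⇒intervalSum≡0 σ π i u 1≤i i≤N omits))
        (ℤ.*-zeroʳ (μ (2 ∷ 1 ∷ []) σ))

-- The permutation π_n

pairs : ℕ → List ℕ → List ℕ
pairs c L = concat (map (λ i → i ∷ c + i ∷ []) L)

∈-pairs⁻ : ∀ c L {y} → y ∈ pairs c L → ∃ λ j → j ∈ L × (y ≡ j ⊎ y ≡ c + j)
∈-pairs⁻ c (x ∷ L) (here refl)         = x , here refl , inj₁ refl
∈-pairs⁻ c (x ∷ L) (there (here refl)) = x , here refl , inj₂ refl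
∈-pairs⁻ c (x ∷ L) (there (there y∈))  = let (j , j∈ , y≡) = ∈-pairs⁻ c L y∈ in j , there j∈ , y≡

Unique-pairs : ∀ c L → Unique L → (∀ {j} → j ∈ L → j < c) → Unique (pairs c L)
Unique-pairs c []      _             _   = []
Unique-pairs c (x ∷ L) u@(_ ∷ u′) L<c = unique-∷ x∉ (unique-∷ cx∉ (Unique-pairs c L u′ (L<c ∘ there)))
  where
    below : ∀ {j} → j ∈ x ∷ L → ∀ k → j < c + k
    below j∈ k = ℕ.<-≤-trans (L<c j∈) (ℕ.m≤m+n c k)
    x∉ : x ∉ c + x ∷ pairs c L
    x∉ (here x≡) = ℕ.<⇒≢ (below (here refl) x) x≡
    x∉ (there x∈) with ∈-pairs⁻ c L x∈
    ... | _ , j∈ , inj₁ refl = Unique[x∷xs]⇒x∉xs u j∈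
    ... | j , _  , inj₂ x≡  = ℕ.<⇒≢ (below (here refl) j) x≡
    cx∉ : c + x ∉ pairs c L
    cx∉ cx∈ with ∈-pairs⁻ c L cx∈
    ... | j , j∈ , inj₁ cx≡j  = ℕ.<⇒≢ (below (there j∈) x) (sym cx≡j)
    ... | j , j∈ , inj₂ cx≡cj = Unique[x∷xs]⇒x∉xs u (subst (_∈ L) (sym (ℕ.+-cancelˡ-≡ c x j cx≡cj)) j∈)

length-pairs : ∀ c L → length (pairs c L) ≡ 2 * length L
length-pairs c []      = refl
length-pairs c (x ∷ L) =
  trans (cong (suc ∘ suc) (length-pairs c L)) (cong suc (sym (ℕ.+-suc (length L) (length L + 0))))

Unique-πseq : ∀ n → Unique (πseq n)
Unique-πseq n = unique-∷ sn∉ (Unique.++⁺ (Unique-pairs c (oneTo n) (Unique-oneTo n) below-c) ([] ∷ [])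
                                        λ { (c∈ , here refl) → c∉mid c∈ })
  where
    c = n + 2
    mid = pairs c (oneTo n)
    below-c : ∀ {j} → j ∈ oneTo n → j < c
    below-c j∈ = ℕ.≤-<-trans (proj₂ (∈-oneTo⁻ j∈)) (ℕ.m<m+n n (s≤s z≤n))
    sn<c : suc n < c
    sn<c = subst (suc n <_) (ℕ.+-comm 2 n) (ℕ.n<1+n (suc n))
    c∉mid : c ∉ mid
    c∉mid c∈ with ∈-pairs⁻ c (oneTo n) c∈
    ... | j , j∈ , inj₁ c≡j  = ℕ.<⇒≢ (below-c j∈) (sym c≡j)
    ... | j , j∈ , inj₂ c≡cj = ℕ.<⇒≢ (ℕ.m<m+n c (proj₁ (∈-oneTo⁻ j∈))) c≡cj
    sn∉ : suc n ∉ mid ++ c ∷ []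
    sn∉ sn∈ with ∈-++⁻ mid sn∈
    ... | inj₂ (here sn≡c) = ℕ.<⇒≢ sn<c sn≡c
    ... | inj₁ sn∈mid with ∈-pairs⁻ c (oneTo n) sn∈mid
    ...   | j , j∈ , inj₁ sn≡j  = ℕ.<⇒≢ (s≤s (proj₂ (∈-oneTo⁻ j∈))) (sym sn≡j)
    ...   | j , _  , inj₂ sn≡cj = ℕ.<⇒≢ (ℕ.<-≤-trans sn<c (ℕ.m≤m+n c j)) sn≡cj

length-πseq : ∀ n → length (πseq n) ≡ 2 * n + 2
length-πseq n = begin
  suc (length (mid ++ n + 2 ∷ []))  ≡⟨ cong suc (length-++ mid) ⟩
  suc (length mid + 1)              ≡⟨ cong (λ l → suc (l + 1)) (trans (length-pairs (n + 2) (oneTo n))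
                                                                       (cong (2 *_) (length-oneTo n))) ⟩
  suc (2 * n + 1)                   ≡⟨ sym (ℕ.+-suc (2 * n) 1) ⟩
  2 * n + 2                         ∎
  where mid = pairs (n + 2) (oneTo n)

lemma13 : (n : ℕ) → 2 ≤ n → (lam : List ℕ) → IsPerm lam →
          (2 ∷ 1 ∷ []) ≤P lam → lam <P πseq n →
          (i : ℕ) → 1 ≤ i → i ≤ 2 * n + 2 → Omits lam (πseq n) i →
          Vanishing lam (πseq n)
lemma13 n _ lam _ _ _ i 1≤i i≤2n+2 omits =
  omits⇒vanishing lam (πseq n) i (Unique-πseq n) 1≤i (subst (i ≤_) (sym (length-πseq n)) i≤2n+2) omits
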